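{- Let $n\ge 3$, let $h$ be a Boolean function on $V_{n-1}$ with $\mathbf{L}_h^{even}\ge 1$, let $b\in V_1$, let $g(x_1,\dots,x_{n-1})=\bigoplus_{i=1}^{n-1}x_i\oplus b$, and let $l$ be either $l(x)=h(x)$ or $l(x)=h(x\oplus a)$ for some $a\in V_{n-1}$ of odd Hamming weight. Suppose $f=(h\,|\,l\oplus g)$ is balanced. Then \[ 2^{n-2}\le N_f\le 2^{n-1}-2^{n/2-1}\sqrt{1+\mathbf{L}_h^{even}}. \] If moreover $h$ is affine (and $f$ is a balanced SAC function of the form $(h\,|\,h\oplus g)$ or $(h\,|\,l\oplus g)$ with $l(x)=h(x\oplus a)$, $a$ of odd weight), then $N_f=2^{n-2}$.
   Context: $V_m=\mathbb{Z}_2^m$. $(h\,|\,k)$ is the function $f$ on $V_n$ with $f(x',0)=h(x')$, $f(x',1)=k(x')$. Balanced means weight $2^{n-1}$. The nonlinearity $N_f$ is the minimum Hamming distance $wt(f\oplus l)$ between $f$ and an affine function $l$ on $V_n$. A nonzero $\alpha$ is a linear structure of $h$ if $h(x)\oplus h(x\oplus\alpha)$ is constant; $\mathbf{L}_h^{even}$ is the number of nonzero linear structures of $h$ of even Hamming weight. $f$ satisfies the SAC if $\sum_x \hat f(x)\hat f(x\oplus c)=0$ for all $c$ of Hamming weight $1$, where $\hat f=(-1)^f$. -}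

module Defs where

open import Data.Bool using (Bool; true; false; _xor_; _∧_; not; if_then_else_)
open import Data.Nat using (ℕ; zero; suc; _+_; _^_; _⊓_)
open import Data.Integer using (ℤ; +_; -[1+_])
import Data.Integer as ℤ
open import Data.List using (List; []; _∷_; _++_; map; foldr; concatMap; length; filter)
open import Data.Vec using (Vec; []; _∷_; init; last; replicate)
open import Data.Product using (Σ; ∃; _×_; _,_)
open import Relation.Binary.PropositionalEquality using (_≡_)
open import Relation.Nullary.Decidable using (⌊_⌋)
import Data.Bool.Properties as BP

allL : {A : Set} → (A → Bool) → List A → Bool
allL p = foldr (λ x r → p x ∧ r) true

V : ℕ → Set
V m = Vec Bool m

BF : ℕ → Set
BF m = V m → Bool

allV : (m : ℕ) → List (V m)
allV zero = [] ∷ []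
allV (suc m) = map (false ∷_) (allV m) ++ map (true ∷_) (allV m)

b2n : Bool → ℕ
b2n true = 1
b2n false = 0

hw : {m : ℕ} → V m → ℕ
hw [] = 0
hw (x ∷ xs) = b2n x + hw xs

isZero : {m : ℕ} → V m → Bool
isZero [] = true
isZero (x ∷ xs) = not x ∧ isZero xs

isEven : ℕ → Bool
isEven zero = true
isEven (suc n) = not (isEven n)

_⊕_ : {m : ℕ} → V m → V m → V m
[] ⊕ [] = []
(x ∷ xs) ⊕ (y ∷ ys) = (x xor y) ∷ (xs ⊕ ys)

dot : {m : ℕ} → V m → V m → Bool
dot [] [] = false
dot (a ∷ as) (x ∷ xs) = (a ∧ x) xor dot as xs

wtF : (m : ℕ) → BF m → ℕ
wtF m f = foldr (λ x s → b2n (f x) + s) 0 (allV m)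

dist : (m : ℕ) → BF m → BF m → ℕ
dist m f g = wtF m (λ x → f x xor g x)

aff : {m : ℕ} → V m → Bool → BF m
aff a c x = dot a x xor c

IsAffine : (m : ℕ) → BF m → Set
IsAffine m h = Σ (V m) λ a → Σ Bool λ c → ∀ x → h x ≡ aff a c x

-- nonlinearity: minimum distance to all affine functions (2^m is an upper bound)
NL : (m : ℕ) → BF m → ℕ
NL m f = foldr _⊓_ (2 ^ m)
  (concatMap (λ a → dist m f (aff a false) ∷ dist m f (aff a true) ∷ []) (allV m))

Balanced : (m : ℕ) → BF (suc m) → Set
Balanced m f = wtF (suc m) f ≡ 2 ^ m

-- α is a (nonzero) linear structure of h: h(x) ⊕ h(x⊕α) constant
isLinStr : (m : ℕ) → BF m → V m → Bool
isLinStr m h α = not (isZero α) ∧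
  allL (λ x → ⌊ BP._≟_ (h x xor h (x ⊕ α)) (h (replicate m false) xor h α) ⌋) (allV m)

Leven : (m : ℕ) → BF m → ℕ
Leven m h = length (filter (λ α → BP.T? (isLinStr m h α ∧ isEven (hw α))) (allV m))

conc : {m : ℕ} → BF m → BF m → BF (suc m)
conc h k x = if last x then k (init x) else h (init x)

gsum : {m : ℕ} → Bool → BF m
gsum b [] = b
gsum b (x ∷ xs) = x xor gsum b xs

sgn : Bool → ℤ
sgn false = + 1
sgn true = -[1+ 0 ]

autoc : (m : ℕ) → BF m → V m → ℤ
autoc m f c = foldr (λ x s → sgn (f x) ℤ.* sgn (f (x ⊕ c)) ℤ.+ s) (+ 0) (allV m)

SAC : (m : ℕ) → BF m → Set
SAC m f = ∀ (c : V m) → hw c ≡ 1 → autoc m f c ≡ + 0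

OddWt : {m : ℕ} → V m → Set
OddWt a = isEven (hw a) ≡ false

fcor : (m : ℕ) → BF m → BF m → Bool → BF (suc m)
fcor m h l b = conc h (λ x → l x xor gsum b x)

{-# OPTIONS --safe #-}
-- With f̂ = (-1)^f and W_f(u) = Σ_x f̂(x)(-1)^{u·x} one has 2·d(f, u·x ⊕ c) = 2^n - (-1)^c W_f(u).
-- Since l is a translate of h and g is affine with linear part 1 = (1,…,1),
-- W_f(α,t) = W_h(α) ± W_h(α ⊕ 1), and Walsh values of h at two distinct points satisfy
-- |W_h(u)| + |W_h(v)| ≤ 2^{n-1}; hence |W_f| ≤ 2^{n-1} and N_f ≥ 2^{n-2}, while balancedness
-- gives N_f ≤ wt f = 2^{n-1}. For the upper bound, Σ W_f⁴ = 2^n Σ Δ_f² and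
-- Σ W_f⁴ ≤ (max W_f²) Σ W_f² = (2^n - 2N_f)² 2^{2n}; here Δ_f(α,0) = Δ_h(α)(1 + (-1)^{wt α}),
-- so α = 0 and every even-weight linear structure α of h contribute Δ_f(α,0)² = 2^{2n}.
-- If h is affine, W_f(a₀,0) = ±2^{n-1} exhibits an affine function at distance 2^{n-2}.
module Submission where

open import Defs
open import Data.Bool using (Bool; true; false; _xor_; _∧_; not; if_then_else_; T)
import Data.Bool.Properties as BP
open import Data.Integer using (ℤ; nonNegative; +_; -[1+_]; _+_; _*_; -_; _-_; _≤_; +≤+; -≤+)
import Data.Integer.Properties as ZP
open import Algebra.Properties.CommutativeSemigroup ZP.+-commutativeSemigroup using (interchange)
open import Data.Integer.Tactic.RingSolver using (solve-∀)
open import Data.List as List using (List; []; _∷_; _++_; concatMap; filter; length)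
open import Data.List.Membership.Propositional using (_∈_)
import Data.List.Membership.Propositional.Properties as ∈
open import Data.List.Relation.Unary.Any using (here; there)
open import Data.Maybe using (just; nothing)
open import Data.Nat as ℕ using (ℕ; zero; suc; _^_; _⊓_; z≤n)
import Data.Nat.Properties as NP
import Data.Nat.Tactic.RingSolver as ℕ-Solver
open import Data.Product using (Σ; _×_; _,_; proj₁; proj₂)
open import Data.Sum using (_⊎_; inj₁; inj₂)
open import Data.Unit using (tt)
open import Data.Vec using ([]; _∷_; _∷ʳ_; replicate; initLast)
import Data.Vec.Properties as VP
open import Level using (0ℓ)
open import Relation.Binary.PropositionalEquality
open import Relation.Nullary using (¬_)
open import Relation.Nullary.Decidable using (toWitness)
import Tactic.RingSolver as RingSolver
open import Tactic.RingSolver.Core.AlmostCommutativeRing using (AlmostCommutativeRing; fromCommutativeRing)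

xor-ring : AlmostCommutativeRing 0ℓ 0ℓ
xor-ring = fromCommutativeRing BP.xor-∧-commutativeRing λ { false → just refl ; true → nothing }

zeros : {m : ℕ} → V m
zeros {m} = replicate m false

ones : {m : ℕ} → V m
ones {m} = replicate m true

⊕-comm : ∀ {m} (x y : V m) → x ⊕ y ≡ y ⊕ x
⊕-comm [] [] = refl
⊕-comm (a ∷ x) (b ∷ y) = cong₂ _∷_ (BP.xor-comm a b) (⊕-comm x y)

⊕-assoc : ∀ {m} (x y z : V m) → (x ⊕ y) ⊕ z ≡ x ⊕ (y ⊕ z)
⊕-assoc [] [] [] = refl
⊕-assoc (a ∷ x) (b ∷ y) (c ∷ z) = cong₂ _∷_ (BP.xor-assoc a b c) (⊕-assoc x y z)

⊕-identityʳ : ∀ {m} (x : V m) → x ⊕ zeros ≡ x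
⊕-identityʳ [] = refl
⊕-identityʳ (a ∷ x) = cong₂ _∷_ (BP.xor-identityʳ a) (⊕-identityʳ x)

⊕-self : ∀ {m} (x : V m) → x ⊕ x ≡ zeros
⊕-self [] = refl
⊕-self (a ∷ x) = cong₂ _∷_ (BP.xor-same a) (⊕-self x)

⊕-cancelʳ : ∀ {m} (x y : V m) → (x ⊕ y) ⊕ y ≡ x
⊕-cancelʳ x y = trans (⊕-assoc x y y) (trans (cong (x ⊕_) (⊕-self y)) (⊕-identityʳ x))

⊕-cancelˡ : ∀ {m} (x y : V m) → x ⊕ (x ⊕ y) ≡ y
⊕-cancelˡ x y = trans (sym (⊕-assoc x x y)) (trans (cong (_⊕ y) (⊕-self x)) (trans (⊕-comm zeros y) (⊕-identityʳ y)))

⊕-right-comm : ∀ {m} (x y z : V m) → (x ⊕ y) ⊕ z ≡ (x ⊕ z) ⊕ y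
⊕-right-comm x y z = trans (⊕-assoc x y z) (trans (cong (x ⊕_) (⊕-comm y z)) (sym (⊕-assoc x z y)))

∷ʳ-⊕ : ∀ {m} (x y : V m) s t → (x ∷ʳ s) ⊕ (y ∷ʳ t) ≡ (x ⊕ y) ∷ʳ (s xor t)
∷ʳ-⊕ [] [] s t = refl
∷ʳ-⊕ (a ∷ x) (b ∷ y) s t = cong ((a xor b) ∷_) (∷ʳ-⊕ x y s t)

ones≢zeros : ∀ {m} → ¬ ones {suc m} ≡ zeros
ones≢zeros ()

isZero⇒≡zeros : ∀ {m} (x : V m) → isZero x ≡ true → x ≡ zeros
isZero⇒≡zeros [] _ = refl
isZero⇒≡zeros (false ∷ x) eq = cong (false ∷_) (isZero⇒≡zeros x eq)

hw-zeros : ∀ {m} → hw (zeros {m}) ≡ 0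
hw-zeros {zero} = refl
hw-zeros {suc m} = hw-zeros {m}

dot-comm : ∀ {m} (u x : V m) → dot u x ≡ dot x u
dot-comm [] [] = refl
dot-comm (a ∷ u) (x ∷ xs) = cong₂ _xor_ (BP.∧-comm a x) (dot-comm u xs)

dot-⊕ʳ : ∀ {m} (u x y : V m) → dot u (x ⊕ y) ≡ dot u x xor dot u y
dot-⊕ʳ [] [] [] = refl
dot-⊕ʳ (a ∷ u) (x ∷ xs) (y ∷ ys) rewrite dot-⊕ʳ u xs ys = distrib a x y (dot u xs) (dot u ys)
  where
  distrib : ∀ a x y p q → (a ∧ (x xor y)) xor (p xor q) ≡ ((a ∧ x) xor p) xor ((a ∧ y) xor q)
  distrib = RingSolver.solve-∀ xor-ring

dot-⊕ˡ : ∀ {m} (u v x : V m) → dot (u ⊕ v) x ≡ dot u x xor dot v x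
dot-⊕ˡ u v x = trans (dot-comm (u ⊕ v) x)
  (trans (dot-⊕ʳ x u v) (cong₂ _xor_ (dot-comm x u) (dot-comm x v)))

dot-zerosˡ : ∀ {m} (x : V m) → dot zeros x ≡ false
dot-zerosˡ [] = refl
dot-zerosˡ (_ ∷ x) = dot-zerosˡ x

dot-∷ʳ : ∀ {m} (a x : V m) s t → dot (a ∷ʳ s) (x ∷ʳ t) ≡ dot a x xor (s ∧ t)
dot-∷ʳ [] [] s t = BP.xor-identityʳ (s ∧ t)
dot-∷ʳ (a ∷ as) (x ∷ xs) s t =
  trans (cong ((a ∧ x) xor_) (dot-∷ʳ as xs s t)) (sym (BP.xor-assoc (a ∧ x) (dot as xs) (s ∧ t)))

dot-ones : ∀ {m} (x : V m) → dot ones x ≡ not (isEven (hw x))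
dot-ones [] = refl
dot-ones (false ∷ x) = dot-ones x
dot-ones (true ∷ x) = cong not (dot-ones x)

gsum≡aff-ones : ∀ {m} b (x : V m) → gsum b x ≡ aff ones b x
gsum≡aff-ones b [] = refl
gsum≡aff-ones b (x ∷ xs) = trans (cong (x xor_) (gsum≡aff-ones b xs)) (sym (BP.xor-assoc x (dot ones xs) b))

aff-xor-aff : ∀ {m} (u v : V m) c e x → aff u c x xor aff v e x ≡ aff (u ⊕ v) (c xor e) x
aff-xor-aff u v c e x rewrite dot-⊕ˡ u v x = regroup (dot u x) (dot v x) c e
  where
  regroup : ∀ p q c e → (p xor c) xor (q xor e) ≡ (p xor q) xor (c xor e)
  regroup = RingSolver.solve-∀ xor-ring

conc-∷ʳ : ∀ {m} (h k : BF m) (x : V m) t → conc h k (x ∷ʳ t) ≡ (if t then k x else h x)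
conc-∷ʳ h k x t rewrite VP.last-∷ʳ t x | VP.init-∷ʳ t x = refl

-- Characters and sums over V_k

sgn-xor : ∀ p q → sgn (p xor q) ≡ sgn p * sgn q
sgn-xor false false = refl
sgn-xor false true = refl
sgn-xor true false = refl
sgn-xor true true = refl

sgn-not : ∀ p → sgn (not p) ≡ - sgn p
sgn-not false = refl
sgn-not true = refl

sgn*sgn : ∀ p → sgn p * sgn p ≡ + 1
sgn*sgn false = refl
sgn*sgn true = refl

χ : ∀ {k} → V k → V k → ℤ
χ u x = sgn (dot u x)

χ-comm : ∀ {k} (u x : V k) → χ u x ≡ χ x u
χ-comm u x = cong sgn (dot-comm u x)

χ-⊕ʳ : ∀ {k} (u x y : V k) → χ u (x ⊕ y) ≡ χ u x * χ u y
χ-⊕ʳ u x y = trans (cong sgn (dot-⊕ʳ u x y)) (sgn-xor (dot u x) (dot u y))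

χ-⊕ˡ : ∀ {k} (u v x : V k) → χ (u ⊕ v) x ≡ χ u x * χ v x
χ-⊕ˡ u v x = trans (cong sgn (dot-⊕ˡ u v x)) (sgn-xor (dot u x) (dot v x))

χ-∷ʳ : ∀ {k} (u x : V k) s t → χ (u ∷ʳ s) (x ∷ʳ t) ≡ χ u x * sgn (s ∧ t)
χ-∷ʳ u x s t = trans (cong sgn (dot-∷ʳ u x s t)) (sgn-xor (dot u x) (s ∧ t))

sgn-xor-aff : ∀ {k} b (v y : V k) e → sgn (b xor aff v e y) ≡ sgn b * (χ v y * sgn e)
sgn-xor-aff b v y e = trans (sgn-xor b (aff v e y)) (cong (sgn b *_) (sgn-xor (dot v y) e))

2^-suc : ∀ k → + (2 ^ suc k) ≡ + (2 ^ k) + + (2 ^ k)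
2^-suc k = trans (cong (λ n → + (2 ^ k ℕ.+ n)) (NP.+-identityʳ (2 ^ k))) (ZP.pos-+ (2 ^ k) (2 ^ k))

∑ : (k : ℕ) → (V k → ℤ) → ℤ
∑ zero F = F []
∑ (suc k) F = ∑ k (λ x → F (false ∷ x)) + ∑ k (λ x → F (true ∷ x))

∑-cong : ∀ k {F G : V k → ℤ} → (∀ x → F x ≡ G x) → ∑ k F ≡ ∑ k G
∑-cong zero eq = eq []
∑-cong (suc k) eq = cong₂ _+_ (∑-cong k (λ x → eq (false ∷ x))) (∑-cong k (λ x → eq (true ∷ x)))

∑-mono : ∀ k {F G : V k → ℤ} → (∀ x → F x ≤ G x) → ∑ k F ≤ ∑ k G
∑-mono zero le = le []
∑-mono (suc k) le = ZP.+-mono-≤ (∑-mono k (λ x → le (false ∷ x))) (∑-mono k (λ x → le (true ∷ x)))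

∑-+ : ∀ k (F G : V k → ℤ) → ∑ k (λ x → F x + G x) ≡ ∑ k F + ∑ k G
∑-+ zero F G = refl
∑-+ (suc k) F G = trans
  (cong₂ _+_ (∑-+ k (λ x → F (false ∷ x)) (λ x → G (false ∷ x))) (∑-+ k (λ x → F (true ∷ x)) (λ x → G (true ∷ x))))
  (interchange (∑ k (λ x → F (false ∷ x))) (∑ k (λ x → G (false ∷ x))) (∑ k (λ x → F (true ∷ x))) (∑ k (λ x → G (true ∷ x))))

∑-*ˡ : ∀ k c (F : V k → ℤ) → ∑ k (λ x → c * F x) ≡ c * ∑ k F
∑-*ˡ zero c F = refl
∑-*ˡ (suc k) c F = trans (cong₂ _+_ (∑-*ˡ k c _) (∑-*ˡ k c _)) (sym (ZP.*-distribˡ-+ c _ _))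

∑-*ʳ : ∀ k c (F : V k → ℤ) → ∑ k (λ x → F x * c) ≡ ∑ k F * c
∑-*ʳ k c F = trans (∑-cong k (λ x → ZP.*-comm (F x) c)) (trans (∑-*ˡ k c F) (ZP.*-comm c _))

∑-neg : ∀ k (F : V k → ℤ) → ∑ k (λ x → - F x) ≡ - ∑ k F
∑-neg k F = trans (∑-cong k (λ x → sym (ZP.-1*i≡-i (F x)))) (trans (∑-*ˡ k (- + 1) F) (ZP.-1*i≡-i _))

∑-const : ∀ k c → ∑ k (λ _ → c) ≡ + (2 ^ k) * c
∑-const zero c = sym (ZP.*-identityˡ c)
∑-const (suc k) c = begin
  ∑ k (λ _ → c) + ∑ k (λ _ → c)      ≡⟨ cong₂ _+_ (∑-const k c) (∑-const k c) ⟩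
  + (2 ^ k) * c + + (2 ^ k) * c      ≡⟨ ZP.*-distribʳ-+ c (+ (2 ^ k)) (+ (2 ^ k)) ⟨
  (+ (2 ^ k) + + (2 ^ k)) * c        ≡⟨ cong (_* c) (2^-suc k) ⟨
  + (2 ^ suc k) * c                  ∎
  where open ≡-Reasoning

∑-translate : ∀ k (a : V k) (F : V k → ℤ) → ∑ k (λ x → F (x ⊕ a)) ≡ ∑ k F
∑-translate zero [] F = refl
∑-translate (suc k) (false ∷ a) F =
  cong₂ _+_ (∑-translate k a (λ x → F (false ∷ x))) (∑-translate k a (λ x → F (true ∷ x)))
∑-translate (suc k) (true ∷ a) F = trans
  (cong₂ _+_ (∑-translate k a (λ x → F (true ∷ x))) (∑-translate k a (λ x → F (false ∷ x))))
  (ZP.+-comm (∑ k (λ x → F (true ∷ x))) (∑ k (λ x → F (false ∷ x))))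

∑-swap : ∀ k l (G : V k → V l → ℤ) → ∑ k (λ x → ∑ l (λ y → G x y)) ≡ ∑ l (λ y → ∑ k (λ x → G x y))
∑-swap zero l G = refl
∑-swap (suc k) l G = trans (cong₂ _+_ (∑-swap k l _) (∑-swap k l _)) (sym (∑-+ l _ _))

∑-∷ʳ : ∀ k (G : V (suc k) → ℤ) → ∑ (suc k) G ≡ ∑ k (λ x → G (x ∷ʳ false)) + ∑ k (λ x → G (x ∷ʳ true))
∑-∷ʳ zero G = refl
∑-∷ʳ (suc k) G = trans
  (cong₂ _+_ (∑-∷ʳ k (λ x → G (false ∷ x))) (∑-∷ʳ k (λ x → G (true ∷ x))))
  (interchange (∑ k (λ x → G (false ∷ (x ∷ʳ false)))) (∑ k (λ x → G (false ∷ (x ∷ʳ true))))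
               (∑ k (λ x → G (true ∷ (x ∷ʳ false)))) (∑ k (λ x → G (true ∷ (x ∷ʳ true)))))

∑-nonneg : ∀ k {F : V k → ℤ} → (∀ x → + 0 ≤ F x) → + 0 ≤ ∑ k F
∑-nonneg k {F} nonneg = subst (_≤ ∑ k F) (trans (∑-const k (+ 0)) (ZP.*-zeroʳ (+ (2 ^ k)))) (∑-mono k nonneg)

∑-isZero : ∀ k → ∑ k (λ α → + b2n (isZero α)) ≡ + 1
∑-isZero zero = refl
∑-isZero (suc k) = trans (cong₂ _+_ (∑-isZero k) (∑-const k (+ 0))) (cong (_+_ (+ 1)) (ZP.*-zeroʳ (+ (2 ^ k))))

∑-χ-nonzero : ∀ {k} (u : V k) → ¬ u ≡ zeros → ∑ k (χ u) ≡ + 0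
∑-χ-nonzero [] u≢0 with () ← u≢0 refl
∑-χ-nonzero {suc k} (false ∷ u) u≢0 rewrite ∑-χ-nonzero u (λ u≡0 → u≢0 (cong (false ∷_) u≡0)) = refl
∑-χ-nonzero {suc k} (true ∷ u) _ = begin
  ∑ k (χ u) + ∑ k (λ x → sgn (not (dot u x)))   ≡⟨ cong (λ s → ∑ k (χ u) + s) (∑-cong k (λ x → sgn-not (dot u x))) ⟩
  ∑ k (χ u) + ∑ k (λ x → - χ u x)                ≡⟨ cong (λ s → ∑ k (χ u) + s) (∑-neg k (χ u)) ⟩
  ∑ k (χ u) - ∑ k (χ u)                          ≡⟨ ZP.+-inverseʳ (∑ k (χ u)) ⟩
  + 0                                            ∎
  where open ≡-Reasoning

∑-χ-zeros : ∀ k → ∑ k (χ zeros) ≡ + (2 ^ k)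
∑-χ-zeros k = trans (∑-cong k (λ x → cong sgn (dot-zerosˡ x))) (trans (∑-const k (+ 1)) (ZP.*-identityʳ (+ (2 ^ k))))

∑-sgn-aff : ∀ {k} (w : V k) e → ¬ w ≡ zeros → ∑ k (λ x → sgn (aff w e x)) ≡ + 0
∑-sgn-aff {k} w e w≢0 = begin
  ∑ k (λ x → sgn (aff w e x))    ≡⟨ ∑-cong k (λ x → sgn-xor (dot w x) e) ⟩
  ∑ k (λ x → χ w x * sgn e)      ≡⟨ ∑-*ʳ k (sgn e) (χ w) ⟩
  ∑ k (χ w) * sgn e              ≡⟨ cong (_* sgn e) (∑-χ-nonzero w w≢0) ⟩
  + 0                            ∎
  where open ≡-Reasoning

orthogonality : ∀ k (H : V k → ℤ) → ∑ k (λ v → H v * ∑ k (χ v)) ≡ + (2 ^ k) * H zeros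
orthogonality zero H = ZP.*-comm (H []) (+ 1)
orthogonality (suc k) H = begin
  ∑ k (λ v → H (false ∷ v) * (∑ k (χ v) + ∑ k (χ v))) + ∑ k (λ v → H (true ∷ v) * ∑ (suc k) (χ (true ∷ v)))
    ≡⟨ cong₂ _+_ (∑-cong k (λ v → ZP.*-distribˡ-+ (H (false ∷ v)) _ _))
                 (∑-cong k (λ v → trans (cong (H (true ∷ v) *_) (∑-χ-nonzero (true ∷ v) λ ())) (ZP.*-zeroʳ (H (true ∷ v))))) ⟩
  ∑ k (λ v → H₀ v * ∑ k (χ v) + H₀ v * ∑ k (χ v)) + ∑ k (λ _ → + 0)
    ≡⟨ cong₂ _+_ (∑-+ k _ _) (trans (∑-const k (+ 0)) (ZP.*-zeroʳ (+ (2 ^ k)))) ⟩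
  (∑ k (λ v → H₀ v * ∑ k (χ v)) + ∑ k (λ v → H₀ v * ∑ k (χ v))) + + 0
    ≡⟨ ZP.+-identityʳ _ ⟩
  ∑ k (λ v → H₀ v * ∑ k (χ v)) + ∑ k (λ v → H₀ v * ∑ k (χ v))
    ≡⟨ cong₂ _+_ (orthogonality k H₀) (orthogonality k H₀) ⟩
  + (2 ^ k) * H₀ zeros + + (2 ^ k) * H₀ zeros
    ≡⟨ trans (cong (_* H₀ zeros) (2^-suc k)) (ZP.*-distribʳ-+ (H₀ zeros) (+ (2 ^ k)) (+ (2 ^ k))) ⟨
  + (2 ^ suc k) * H zeros
    ∎
  where
  open ≡-Reasoning
  H₀ : V k → ℤ
  H₀ v = H (false ∷ v)

-- Walsh spectrum and autocorrelation

walsh : ∀ {k} → BF k → V k → ℤ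
walsh {k} f u = ∑ k (λ x → sgn (f x) * χ u x)

Δ : ∀ {k} → BF k → V k → ℤ
Δ {k} f β = ∑ k (λ x → sgn (f x) * sgn (f (x ⊕ β)))

walsh-cong : ∀ {k} {f g : BF k} → (∀ x → f x ≡ g x) → ∀ u → walsh f u ≡ walsh g u
walsh-cong {k} eq u = ∑-cong k (λ x → cong (λ b → sgn b * χ u x) (eq x))

Δ-cong : ∀ {k} {f g : BF k} → (∀ x → f x ≡ g x) → ∀ β → Δ f β ≡ Δ g β
Δ-cong {k} eq β = ∑-cong k (λ x → cong₂ (λ p q → sgn p * sgn q) (eq x) (eq (x ⊕ β)))

walsh²≡∑Δχ : ∀ {k} (f : BF k) u → walsh f u * walsh f u ≡ ∑ k (λ β → Δ f β * χ β u)
walsh²≡∑Δχ {k} f u = begin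
  walsh f u * walsh f u                                   ≡⟨ ∑-*ʳ k (walsh f u) A ⟨
  ∑ k (λ x → A x * walsh f u)                             ≡⟨ ∑-cong k (λ x → ∑-*ˡ k (A x) A) ⟨
  ∑ k (λ x → ∑ k (λ y → A x * A y))                       ≡⟨ ∑-cong k (λ x → ∑-translate k x (λ y → A x * A y)) ⟨
  ∑ k (λ x → ∑ k (λ β → A x * A (β ⊕ x)))                 ≡⟨ ∑-cong k (λ x → ∑-cong k (λ β → pair x β)) ⟩
  ∑ k (λ x → ∑ k (λ β → (sgn (f x) * sgn (f (x ⊕ β))) * χ β u))
                                                          ≡⟨ ∑-swap k k _ ⟩
  ∑ k (λ β → ∑ k (λ x → (sgn (f x) * sgn (f (x ⊕ β))) * χ β u))
                                                          ≡⟨ ∑-cong k (λ β → ∑-*ʳ k (χ β u) _) ⟩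
  ∑ k (λ β → Δ f β * χ β u)                               ∎
  where
  open ≡-Reasoning
  A : V k → ℤ
  A y = sgn (f y) * χ u y
  regroup : ∀ a b c d → (a * c) * (b * (c * d)) ≡ ((a * b) * d) * (c * c)
  regroup = solve-∀
  pair : ∀ x β → A x * A (β ⊕ x) ≡ (sgn (f x) * sgn (f (x ⊕ β))) * χ β u
  pair x β rewrite ⊕-comm β x | χ-⊕ʳ u x β
                 | regroup (sgn (f x)) (sgn (f (x ⊕ β))) (χ u x) (χ u β)
                 | sgn*sgn (dot u x) | χ-comm u β = ZP.*-identityʳ _

Δ-zeros : ∀ {k} (f : BF k) → Δ f zeros ≡ + (2 ^ k)
Δ-zeros {k} f = begin
  ∑ k (λ x → sgn (f x) * sgn (f (x ⊕ zeros)))  ≡⟨ ∑-cong k (λ x → cong (λ y → sgn (f x) * sgn (f y)) (⊕-identityʳ x)) ⟩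
  ∑ k (λ x → sgn (f x) * sgn (f x))            ≡⟨ ∑-cong k (λ x → sgn*sgn (f x)) ⟩
  ∑ k (λ _ → + 1)                              ≡⟨ ∑-const k (+ 1) ⟩
  + (2 ^ k) * + 1                              ≡⟨ ZP.*-identityʳ _ ⟩
  + (2 ^ k)                                    ∎
  where open ≡-Reasoning

parseval : ∀ {k} (f : BF k) → ∑ k (λ u → walsh f u * walsh f u) ≡ + (2 ^ k) * + (2 ^ k)
parseval {k} f = begin
  ∑ k (λ u → walsh f u * walsh f u)            ≡⟨ ∑-cong k (walsh²≡∑Δχ f) ⟩
  ∑ k (λ u → ∑ k (λ β → Δ f β * χ β u))        ≡⟨ ∑-swap k k _ ⟩
  ∑ k (λ β → ∑ k (λ u → Δ f β * χ β u))        ≡⟨ ∑-cong k (λ β → ∑-*ˡ k (Δ f β) (χ β)) ⟩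
  ∑ k (λ β → Δ f β * ∑ k (χ β))                ≡⟨ orthogonality k (Δ f) ⟩
  + (2 ^ k) * Δ f zeros                        ≡⟨ cong (+ (2 ^ k) *_) (Δ-zeros f) ⟩
  + (2 ^ k) * + (2 ^ k)                        ∎
  where open ≡-Reasoning

∑walsh⁴≡∑Δ² : ∀ {k} (f : BF k) →
  ∑ k (λ u → (walsh f u * walsh f u) * (walsh f u * walsh f u)) ≡ + (2 ^ k) * ∑ k (λ β → Δ f β * Δ f β)
∑walsh⁴≡∑Δ² {k} f = begin
  ∑ k (λ u → W² u * W² u)                                         ≡⟨ ∑-cong k expand ⟩
  ∑ k (λ u → ∑ k (λ β → ∑ k (λ γ → (Δ f β * Δ f γ) * χ (β ⊕ γ) u)))
                                                                  ≡⟨ ∑-swap k k _ ⟩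
  ∑ k (λ β → ∑ k (λ u → ∑ k (λ γ → (Δ f β * Δ f γ) * χ (β ⊕ γ) u)))
                                                                  ≡⟨ ∑-cong k (λ β → ∑-swap k k _) ⟩
  ∑ k (λ β → ∑ k (λ γ → ∑ k (λ u → (Δ f β * Δ f γ) * χ (β ⊕ γ) u)))
                                                                  ≡⟨ ∑-cong k (λ β → ∑-cong k (λ γ → ∑-*ˡ k (Δ f β * Δ f γ) (χ (β ⊕ γ)))) ⟩
  ∑ k (λ β → ∑ k (λ γ → (Δ f β * Δ f γ) * ∑ k (χ (β ⊕ γ))))      ≡⟨ ∑-cong k collapse ⟩
  ∑ k (λ β → + (2 ^ k) * (Δ f β * Δ f β))                         ≡⟨ ∑-*ˡ k (+ (2 ^ k)) _ ⟩
  + (2 ^ k) * ∑ k (λ β → Δ f β * Δ f β)                           ∎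
  where
  open ≡-Reasoning
  W² : V k → ℤ
  W² u = walsh f u * walsh f u
  regroup : ∀ a b c d → (a * c) * (b * d) ≡ (a * b) * (c * d)
  regroup = solve-∀
  expand : ∀ u → W² u * W² u ≡ ∑ k (λ β → ∑ k (λ γ → (Δ f β * Δ f γ) * χ (β ⊕ γ) u))
  expand u = begin
    W² u * W² u                                                   ≡⟨ cong₂ _*_ (walsh²≡∑Δχ f u) (walsh²≡∑Δχ f u) ⟩
    ∑ k (λ β → Δ f β * χ β u) * ∑ k (λ γ → Δ f γ * χ γ u)         ≡⟨ ∑-*ʳ k _ (λ β → Δ f β * χ β u) ⟨
    ∑ k (λ β → (Δ f β * χ β u) * ∑ k (λ γ → Δ f γ * χ γ u))       ≡⟨ ∑-cong k (λ β → ∑-*ˡ k (Δ f β * χ β u) (λ γ → Δ f γ * χ γ u)) ⟨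
    ∑ k (λ β → ∑ k (λ γ → (Δ f β * χ β u) * (Δ f γ * χ γ u)))     ≡⟨ ∑-cong k (λ β → ∑-cong k (λ γ →
                                                                      trans (regroup (Δ f β) (Δ f γ) (χ β u) (χ γ u))
                                                                            (cong ((Δ f β * Δ f γ) *_) (sym (χ-⊕ˡ β γ u))))) ⟩
    ∑ k (λ β → ∑ k (λ γ → (Δ f β * Δ f γ) * χ (β ⊕ γ) u))         ∎
  collapse : ∀ β → ∑ k (λ γ → (Δ f β * Δ f γ) * ∑ k (χ (β ⊕ γ))) ≡ + (2 ^ k) * (Δ f β * Δ f β)
  collapse β = begin
    ∑ k (λ γ → (Δ f β * Δ f γ) * ∑ k (χ (β ⊕ γ)))                 ≡⟨ ∑-translate k β _ ⟨
    ∑ k (λ γ → (Δ f β * Δ f (γ ⊕ β)) * ∑ k (χ (β ⊕ (γ ⊕ β))))     ≡⟨ ∑-cong k (λ γ → cong (λ v → (Δ f β * Δ f (γ ⊕ β)) * ∑ k (χ v))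
                                                                        (trans (⊕-comm β (γ ⊕ β)) (⊕-cancelʳ γ β))) ⟩
    ∑ k (λ γ → (Δ f β * Δ f (γ ⊕ β)) * ∑ k (χ γ))                 ≡⟨ orthogonality k (λ γ → Δ f β * Δ f (γ ⊕ β)) ⟩
    + (2 ^ k) * (Δ f β * Δ f (zeros ⊕ β))                         ≡⟨ cong (λ v → + (2 ^ k) * (Δ f β * Δ f v)) (trans (⊕-comm zeros β) (⊕-identityʳ β)) ⟩
    + (2 ^ k) * (Δ f β * Δ f β)                                   ∎

walsh-aff : ∀ {k} (v : V k) e u → walsh (aff v e) u ≡ sgn e * ∑ k (χ (u ⊕ v))
walsh-aff {k} v e u = trans (∑-cong k pointwise) (∑-*ˡ k (sgn e) (χ (u ⊕ v)))
  where
  regroup : ∀ a E b → (a * E) * b ≡ E * (b * a)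
  regroup = solve-∀
  pointwise : ∀ x → sgn (aff v e x) * χ u x ≡ sgn e * χ (u ⊕ v) x
  pointwise x = trans (cong (_* χ u x) (sgn-xor (dot v x) e))
    (trans (regroup (χ v x) (sgn e) (χ u x)) (cong (sgn e *_) (sym (χ-⊕ˡ u v x))))

walsh-translate : ∀ {k} (h : BF k) (a u : V k) → walsh (λ x → h (x ⊕ a)) u ≡ χ u a * walsh h u
walsh-translate {k} h a u = begin
  ∑ k (λ x → sgn (h (x ⊕ a)) * χ u x)                   ≡⟨ ∑-translate k a (λ y → sgn (h (y ⊕ a)) * χ u y) ⟨
  ∑ k (λ x → sgn (h ((x ⊕ a) ⊕ a)) * χ u (x ⊕ a))       ≡⟨ ∑-cong k shifted ⟩
  ∑ k (λ x → χ u a * (sgn (h x) * χ u x))               ≡⟨ ∑-*ˡ k (χ u a) (λ x → sgn (h x) * χ u x) ⟩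
  χ u a * walsh h u                                     ∎
  where
  open ≡-Reasoning
  regroup : ∀ s c d → s * (c * d) ≡ d * (s * c)
  regroup = solve-∀
  shifted : ∀ x → sgn (h ((x ⊕ a) ⊕ a)) * χ u (x ⊕ a) ≡ χ u a * (sgn (h x) * χ u x)
  shifted x rewrite ⊕-cancelʳ x a | χ-⊕ʳ u x a = regroup (sgn (h x)) (χ u x) (χ u a)

walsh-xor-aff : ∀ {k} (h : BF k) (v : V k) e u → walsh (λ x → h x xor aff v e x) u ≡ sgn e * walsh h (u ⊕ v)
walsh-xor-aff {k} h v e u = trans (∑-cong k twisted) (∑-*ˡ k (sgn e) (λ x → sgn (h x) * χ (u ⊕ v) x))
  where
  regroup : ∀ s c d E → (s * (c * E)) * d ≡ E * (s * (d * c))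
  regroup = solve-∀
  twisted : ∀ x → sgn (h x xor aff v e x) * χ u x ≡ sgn e * (sgn (h x) * χ (u ⊕ v) x)
  twisted x = begin
    sgn (h x xor aff v e x) * χ u x              ≡⟨ cong (_* χ u x) (sgn-xor-aff (h x) v x e) ⟩
    (sgn (h x) * (χ v x * sgn e)) * χ u x        ≡⟨ regroup (sgn (h x)) (χ v x) (χ u x) (sgn e) ⟩
    sgn e * (sgn (h x) * (χ u x * χ v x))        ≡⟨ cong (λ c → sgn e * (sgn (h x) * c)) (χ-⊕ˡ u v x) ⟨
    sgn e * (sgn (h x) * χ (u ⊕ v) x)            ∎
    where open ≡-Reasoning

walsh-conc : ∀ {m} (h k : BF m) α t → walsh (conc h k) (α ∷ʳ t) ≡ walsh h α + sgn t * walsh k α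
walsh-conc {m} h k α t = trans (∑-∷ʳ m (λ x → sgn (conc h k x) * χ (α ∷ʳ t) x))
  (cong₂ _+_ (∑-cong m left) (trans (∑-cong m right) (∑-*ˡ m (sgn t) (λ x → sgn (k x) * χ α x))))
  where
  regroup : ∀ s c T → s * (c * T) ≡ T * (s * c)
  regroup = solve-∀
  left : ∀ x → sgn (conc h k (x ∷ʳ false)) * χ (α ∷ʳ t) (x ∷ʳ false) ≡ sgn (h x) * χ α x
  left x rewrite conc-∷ʳ h k x false | χ-∷ʳ α x t false | BP.∧-zeroʳ t = cong (sgn (h x) *_) (ZP.*-identityʳ (χ α x))
  right : ∀ x → sgn (conc h k (x ∷ʳ true)) * χ (α ∷ʳ t) (x ∷ʳ true) ≡ sgn t * (sgn (k x) * χ α x)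
  right x rewrite conc-∷ʳ h k x true | χ-∷ʳ α x t true | BP.∧-identityʳ t = regroup (sgn (k x)) (χ α x) (sgn t)

sgn*walsh≡∑ : ∀ {k} (f : BF k) u c → sgn c * walsh f u ≡ ∑ k (λ x → sgn (f x xor aff u c x))
sgn*walsh≡∑ {k} f u c = trans (sym (∑-*ˡ k (sgn c) (λ x → sgn (f x) * χ u x))) (∑-cong k pointwise)
  where
  regroup : ∀ C s a → C * (s * a) ≡ s * (a * C)
  regroup = solve-∀
  pointwise : ∀ x → sgn c * (sgn (f x) * χ u x) ≡ sgn (f x xor aff u c x)
  pointwise x = trans (regroup (sgn c) (sgn (f x)) (χ u x)) (sym (sgn-xor-aff (f x) u x c))

walsh-two-point-bound : ∀ {k} (f : BF k) {u v : V k} → ¬ u ⊕ v ≡ zeros → ∀ c e →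
  sgn c * walsh f u + sgn e * walsh f v ≤ + (2 ^ k)
walsh-two-point-bound {k} f {u} {v} u⊕v≢0 c e = begin
  sgn c * walsh f u + sgn e * walsh f v
    ≡⟨ cong₂ _+_ (sgn*walsh≡∑ f u c) (sgn*walsh≡∑ f v e) ⟩
  ∑ k (λ x → sgn (f x xor aff u c x)) + ∑ k (λ x → sgn (f x xor aff v e x))
    ≡⟨ ∑-+ k (λ x → sgn (f x xor aff u c x)) (λ x → sgn (f x xor aff v e x)) ⟨
  ∑ k (λ x → sgn (f x xor aff u c x) + sgn (f x xor aff v e x))
    ≤⟨ ∑-mono k (λ x → pointwise (f x) (aff u c x) (aff v e x)) ⟩
  ∑ k (λ x → + 1 + sgn (aff u c x xor aff v e x))
    ≡⟨ ∑-+ k (λ _ → + 1) (λ x → sgn (aff u c x xor aff v e x)) ⟩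
  ∑ k (λ _ → + 1) + ∑ k (λ x → sgn (aff u c x xor aff v e x))
    ≡⟨ cong₂ _+_ (trans (∑-const k (+ 1)) (ZP.*-identityʳ (+ (2 ^ k))))
                 (trans (∑-cong k (λ x → cong sgn (aff-xor-aff u v c e x))) (∑-sgn-aff (u ⊕ v) (c xor e) u⊕v≢0)) ⟩
  + (2 ^ k) + + 0
    ≡⟨ ZP.+-identityʳ (+ (2 ^ k)) ⟩
  + (2 ^ k)
    ∎
  where
  open ZP.≤-Reasoning
  pointwise : ∀ s p q → sgn (s xor p) + sgn (s xor q) ≤ + 1 + sgn (p xor q)
  pointwise false false false = ZP.≤-refl
  pointwise false false true = ZP.≤-refl
  pointwise false true false = ZP.≤-refl
  pointwise false true true = -≤+
  pointwise true false false = -≤+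
  pointwise true false true = ZP.≤-refl
  pointwise true true false = ZP.≤-refl
  pointwise true true true = ZP.≤-refl

Δ-translate : ∀ {k} (h : BF k) (a β : V k) → Δ (λ x → h (x ⊕ a)) β ≡ Δ h β
Δ-translate {k} h a β = trans (sym (∑-translate k a (λ y → sgn (h (y ⊕ a)) * sgn (h ((y ⊕ β) ⊕ a))))) (∑-cong k shifted)
  where
  shifted : ∀ x → sgn (h ((x ⊕ a) ⊕ a)) * sgn (h (((x ⊕ a) ⊕ β) ⊕ a)) ≡ sgn (h x) * sgn (h (x ⊕ β))
  shifted x rewrite ⊕-cancelʳ x a | ⊕-right-comm (x ⊕ a) β a | ⊕-cancelʳ x a = refl

Δ-xor-aff : ∀ {k} (h : BF k) (v : V k) e β → Δ (λ x → h x xor aff v e x) β ≡ χ v β * Δ h β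
Δ-xor-aff {k} h v e β = trans (∑-cong k twisted) (∑-*ˡ k (χ v β) (λ x → sgn (h x) * sgn (h (x ⊕ β))))
  where
  regroup : ∀ s s' c d E → (s * (c * E)) * (s' * ((c * d) * E)) ≡ (d * (s * s')) * ((c * c) * (E * E))
  regroup = solve-∀
  twisted : ∀ x → sgn (h x xor aff v e x) * sgn (h (x ⊕ β) xor aff v e (x ⊕ β)) ≡ χ v β * (sgn (h x) * sgn (h (x ⊕ β)))
  twisted x = begin
    sgn (h x xor aff v e x) * sgn (h (x ⊕ β) xor aff v e (x ⊕ β))
      ≡⟨ cong₂ _*_ (sgn-xor-aff (h x) v x e) (sgn-xor-aff (h (x ⊕ β)) v (x ⊕ β) e) ⟩
    (s * (c * E)) * (s' * (χ v (x ⊕ β) * E))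
      ≡⟨ cong (λ z → (s * (c * E)) * (s' * (z * E))) (χ-⊕ʳ v x β) ⟩
    (s * (c * E)) * (s' * ((c * d) * E))
      ≡⟨ regroup s s' c d E ⟩
    (d * (s * s')) * ((c * c) * (E * E))
      ≡⟨ cong₂ (λ p q → (d * (s * s')) * (p * q)) (sgn*sgn (dot v x)) (sgn*sgn e) ⟩
    (d * (s * s')) * + 1
      ≡⟨ ZP.*-identityʳ (d * (s * s')) ⟩
    d * (s * s')
      ∎
    where
    open ≡-Reasoning
    s = sgn (h x)
    s' = sgn (h (x ⊕ β))
    c = χ v x
    d = χ v β
    E = sgn e

Δ-conc : ∀ {m} (h k : BF m) α → Δ (conc h k) (α ∷ʳ false) ≡ Δ h α + Δ k α
Δ-conc {m} h k α = trans (∑-∷ʳ m (λ x → sgn (conc h k x) * sgn (conc h k (x ⊕ (α ∷ʳ false)))))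
  (cong₂ _+_ (∑-cong m (halves false)) (∑-cong m (halves true)))
  where
  halves : ∀ t x → sgn (conc h k (x ∷ʳ t)) * sgn (conc h k ((x ∷ʳ t) ⊕ (α ∷ʳ false)))
                 ≡ sgn (if t then k x else h x) * sgn (if t then k (x ⊕ α) else h (x ⊕ α))
  halves t x rewrite ∷ʳ-⊕ x α t false | BP.xor-identityʳ t | conc-∷ʳ h k x t | conc-∷ʳ h k (x ⊕ α) t = refl

Δ-linear-structure : ∀ {k} (h : BF k) α c → (∀ x → h x xor h (x ⊕ α) ≡ c) → Δ h α ≡ + (2 ^ k) * sgn c
Δ-linear-structure {k} h α c ls = trans
  (∑-cong k (λ x → trans (sym (sgn-xor (h x) (h (x ⊕ α)))) (cong sgn (ls x))))
  (∑-const k (sgn c))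

-- Distances and nonlinearity

∈-allV : ∀ {m} (x : V m) → x ∈ allV m
∈-allV [] = here refl
∈-allV {suc m} (false ∷ x) = ∈.∈-++⁺ˡ (∈.∈-map⁺ (false ∷_) (∈-allV x))
∈-allV {suc m} (true ∷ x) = ∈.∈-++⁺ʳ (List.map (false ∷_) (allV m)) (∈.∈-map⁺ (true ∷_) (∈-allV x))

allL-sound : ∀ {A : Set} (p : A → Bool) {xs x} → allL p xs ≡ true → x ∈ xs → p x ≡ true
allL-sound p {y ∷ _} all (here refl) with p y
... | true = refl
allL-sound p {y ∷ _} all (there x∈xs) with p y
... | true = allL-sound p all x∈xs

count : ∀ {A : Set} → (A → Bool) → List A → ℕ
count p = List.foldr (λ x n → b2n (p x) ℕ.+ n) 0

∑-foldr : ∀ {A : Set} → (A → ℤ) → List A → ℤ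
∑-foldr F = List.foldr (λ x s → F x + s) (+ 0)

length-filter≡count : ∀ {A : Set} (p : A → Bool) xs → length (filter (λ x → BP.T? (p x)) xs) ≡ count p xs
length-filter≡count p [] = refl
length-filter≡count p (x ∷ xs) with p x
... | true = cong suc (length-filter≡count p xs)
... | false = length-filter≡count p xs

+count≡∑-foldr : ∀ {A : Set} (p : A → Bool) xs → + count p xs ≡ ∑-foldr (λ x → + b2n (p x)) xs
+count≡∑-foldr p [] = refl
+count≡∑-foldr p (x ∷ xs) = trans (ZP.pos-+ (b2n (p x)) (count p xs)) (cong (_+_ (+ b2n (p x))) (+count≡∑-foldr p xs))

∑-foldr-++ : ∀ {A : Set} (F : A → ℤ) xs ys → ∑-foldr F (xs ++ ys) ≡ ∑-foldr F xs + ∑-foldr F ys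
∑-foldr-++ F [] ys = sym (ZP.+-identityˡ _)
∑-foldr-++ F (x ∷ xs) ys = trans (cong (_+_ (F x)) (∑-foldr-++ F xs ys)) (sym (ZP.+-assoc (F x) (∑-foldr F xs) (∑-foldr F ys)))

∑-foldr-map : ∀ {A B : Set} (F : B → ℤ) (g : A → B) xs → ∑-foldr F (List.map g xs) ≡ ∑-foldr (λ x → F (g x)) xs
∑-foldr-map F g [] = refl
∑-foldr-map F g (x ∷ xs) = cong (_+_ (F (g x))) (∑-foldr-map F g xs)

∑-foldr-allV : ∀ k (F : V k → ℤ) → ∑-foldr F (allV k) ≡ ∑ k F
∑-foldr-allV zero F = ZP.+-identityʳ (F [])
∑-foldr-allV (suc k) F = begin
  ∑-foldr F (List.map (false ∷_) (allV k) ++ List.map (true ∷_) (allV k))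
    ≡⟨ ∑-foldr-++ F (List.map (false ∷_) (allV k)) (List.map (true ∷_) (allV k)) ⟩
  ∑-foldr F (List.map (false ∷_) (allV k)) + ∑-foldr F (List.map (true ∷_) (allV k))
    ≡⟨ cong₂ _+_ (∑-foldr-map F (false ∷_) (allV k)) (∑-foldr-map F (true ∷_) (allV k)) ⟩
  ∑-foldr (λ x → F (false ∷ x)) (allV k) + ∑-foldr (λ x → F (true ∷ x)) (allV k)
    ≡⟨ cong₂ _+_ (∑-foldr-allV k (λ x → F (false ∷ x))) (∑-foldr-allV k (λ x → F (true ∷ x))) ⟩
  ∑ (suc k) F
    ∎
  where open ≡-Reasoning

+wtF≡∑ : ∀ k (f : BF k) → + wtF k f ≡ ∑ k (λ x → + b2n (f x))
+wtF≡∑ k f = trans (+count≡∑-foldr f (allV k)) (∑-foldr-allV k (λ x → + b2n (f x)))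

count-cong : ∀ {A : Set} {p q : A → Bool} → (∀ x → p x ≡ q x) → ∀ xs → count p xs ≡ count q xs
count-cong eq [] = refl
count-cong eq (x ∷ xs) = cong₂ ℕ._+_ (cong b2n (eq x)) (count-cong eq xs)

dist-walsh : ∀ k (f : BF k) u c → + dist k f (aff u c) + + dist k f (aff u c) ≡ + (2 ^ k) - sgn c * walsh f u
dist-walsh k f u c = begin
  + dist k f (aff u c) + + dist k f (aff u c)          ≡⟨ cong₂ _+_ (+wtF≡∑ k _) (+wtF≡∑ k _) ⟩
  ∑ k B + ∑ k B                                        ≡⟨ ∑-+ k B B ⟨
  ∑ k (λ x → B x + B x)                                ≡⟨ ∑-cong k (λ x → b2n+b2n (f x xor aff u c x)) ⟩
  ∑ k (λ x → + 1 - sgn (f x xor aff u c x))            ≡⟨ ∑-+ k (λ _ → + 1) (λ x → - sgn (f x xor aff u c x)) ⟩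
  ∑ k (λ _ → + 1) + ∑ k (λ x → - sgn (f x xor aff u c x))
    ≡⟨ cong₂ _+_ (trans (∑-const k (+ 1)) (ZP.*-identityʳ (+ (2 ^ k))))
                 (trans (∑-neg k (λ x → sgn (f x xor aff u c x))) (cong -_ (sym (sgn*walsh≡∑ f u c)))) ⟩
  + (2 ^ k) - sgn c * walsh f u                        ∎
  where
  open ≡-Reasoning
  B : V k → ℤ
  B x = + b2n (f x xor aff u c x)
  b2n+b2n : ∀ p → + b2n p + + b2n p ≡ + 1 - sgn p
  b2n+b2n false = refl
  b2n+b2n true = refl

module _ {A : Set} (φ ψ : A → ℕ) (z : ℕ) where

  min₂ : List A → ℕ
  min₂ xs = List.foldr _⊓_ z (concatMap (λ a → φ a ∷ ψ a ∷ []) xs)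

  min₂≤ : ∀ {xs x} → x ∈ xs → min₂ xs ℕ.≤ φ x × min₂ xs ℕ.≤ ψ x
  min₂≤ {y ∷ _} (here refl) = NP.m⊓n≤m (φ y) _ , NP.≤-trans (NP.m⊓n≤n (φ y) _) (NP.m⊓n≤m (ψ y) _)
  min₂≤ {y ∷ xs} (there x∈xs) =
    let drop = NP.≤-trans (NP.m⊓n≤n (φ y) _) (NP.m⊓n≤n (ψ y) (min₂ xs)) in
    NP.≤-trans drop (proj₁ (min₂≤ x∈xs)) , NP.≤-trans drop (proj₂ (min₂≤ x∈xs))

  ≤min₂ : ∀ {j} xs → (∀ a → j ℕ.≤ φ a) → (∀ a → j ℕ.≤ ψ a) → j ℕ.≤ z → j ℕ.≤ min₂ xs
  ≤min₂ [] _ _ j≤z = j≤z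
  ≤min₂ (y ∷ xs) j≤φ j≤ψ j≤z = NP.⊓-glb (j≤φ y) (NP.⊓-glb (j≤ψ y) (≤min₂ xs j≤φ j≤ψ j≤z))

NL≤dist : ∀ k (f : BF k) u c → NL k f ℕ.≤ dist k f (aff u c)
NL≤dist k f u false = proj₁ (min₂≤ (λ a → dist k f (aff a false)) (λ a → dist k f (aff a true)) (2 ^ k) (∈-allV u))
NL≤dist k f u true = proj₂ (min₂≤ (λ a → dist k f (aff a false)) (λ a → dist k f (aff a true)) (2 ^ k) (∈-allV u))

≤NL : ∀ k (f : BF k) {j} → j ℕ.≤ 2 ^ k → (∀ u c → j ℕ.≤ dist k f (aff u c)) → j ℕ.≤ NL k f
≤NL k f j≤2^k j≤dist =
  ≤min₂ (λ a → dist k f (aff a false)) (λ a → dist k f (aff a true)) (2 ^ k) (allV k) (λ a → j≤dist a false) (λ a → j≤dist a true) j≤2^k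

NL≤wtF : ∀ k (f : BF k) → NL k f ℕ.≤ wtF k f
NL≤wtF k f = subst (NL k f ℕ.≤_) (count-cong distance-to-zero (allV k)) (NL≤dist k f zeros false)
  where
  distance-to-zero : ∀ x → f x xor aff zeros false x ≡ f x
  distance-to-zero x rewrite dot-zerosˡ x = BP.xor-identityʳ (f x)

sgn*walsh≤ : ∀ k (f : BF k) u c → sgn c * walsh f u ≤ + (2 ^ k) - (+ NL k f + + NL k f)
sgn*walsh≤ k f u c = begin
  sgn c * walsh f u                                       ≡⟨ shuffle (+ (2 ^ k)) (sgn c * walsh f u) ⟩
  + (2 ^ k) - (+ (2 ^ k) - sgn c * walsh f u)             ≡⟨ cong (λ z → + (2 ^ k) - z) (dist-walsh k f u c) ⟨
  + (2 ^ k) - (+ d + + d)                                 ≤⟨ ZP.+-monoʳ-≤ (+ (2 ^ k)) (ZP.neg-mono-≤ (ZP.+-mono-≤ NL≤d NL≤d)) ⟩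
  + (2 ^ k) - (+ NL k f + + NL k f)                       ∎
  where
  open ZP.≤-Reasoning
  d = dist k f (aff u c)
  NL≤d : + NL k f ≤ + d
  NL≤d = +≤+ (NL≤dist k f u c)
  shuffle : ∀ T w → w ≡ T - (T - w)
  shuffle = solve-∀

square-nonneg : ∀ i → + 0 ≤ i * i
square-nonneg (+ n) = subst (+ 0 ≤_) (ZP.pos-* n n) (+≤+ z≤n)
square-nonneg -[1+ n ] = +≤+ z≤n

square-mono : ∀ {w a} → w ≤ a → - w ≤ a → w * w ≤ a * a
square-mono {w} {a} w≤a -w≤a = ZP.0≤i-j⇒j≤i (subst (+ 0 ≤_) (factorise a w) (nonneg-* (ZP.i≤j⇒0≤j-i w≤a) (ZP.i≤j⇒0≤j-i -w≤a)))
  where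
  nonneg-* : ∀ {i j} → + 0 ≤ i → + 0 ≤ j → + 0 ≤ i * j
  nonneg-* {+ m} {+ n} _ _ = subst (+ 0 ≤_) (ZP.pos-* m n) (+≤+ z≤n)
  factorise : ∀ a w → (a - w) * (a - - w) ≡ a * a - w * w
  factorise = solve-∀

walsh²≤ : ∀ k (f : BF k) u → let A = + (2 ^ k) - (+ NL k f + + NL k f) in walsh f u * walsh f u ≤ A * A
walsh²≤ k f u = square-mono
  (subst (_≤ _) (ZP.*-identityˡ (walsh f u)) (sgn*walsh≤ k f u false))
  (subst (_≤ _) (ZP.-1*i≡-i (walsh f u)) (sgn*walsh≤ k f u true))

fourth-moment-bound : ∀ k (f : BF k) → let A = + (2 ^ k) - (+ NL k f + + NL k f) in
  + (2 ^ k) * ∑ k (λ β → Δ f β * Δ f β) ≤ (A * A) * (+ (2 ^ k) * + (2 ^ k))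
fourth-moment-bound k f = begin
  + (2 ^ k) * ∑ k (λ β → Δ f β * Δ f β)     ≡⟨ ∑walsh⁴≡∑Δ² f ⟨
  ∑ k (λ u → W² u * W² u)                   ≤⟨ ∑-mono k (λ u → ZP.*-monoʳ-≤-nonNeg (W² u) {{nonNegative (square-nonneg (walsh f u))}} (walsh²≤ k f u)) ⟩
  ∑ k (λ u → (A * A) * W² u)                ≡⟨ ∑-*ˡ k (A * A) W² ⟩
  (A * A) * ∑ k W²                          ≡⟨ cong ((A * A) *_) (parseval f) ⟩
  (A * A) * (+ (2 ^ k) * + (2 ^ k))         ∎
  where
  open ZP.≤-Reasoning
  A = + (2 ^ k) - (+ NL k f + + NL k f)
  W² : V k → ℤ
  W² u = walsh f u * walsh f u

∧-true : ∀ {x y} → x ∧ y ≡ true → x ≡ true × y ≡ true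
∧-true {true} {true} _ = refl , refl

isLinStr⇒linear-structure : ∀ m (h : BF m) α → isLinStr m h α ≡ true →
  ∀ x → h x xor h (x ⊕ α) ≡ h zeros xor h α
isLinStr⇒linear-structure m h α ls x with isZero α
isLinStr⇒linear-structure m h α ls x | false =
  toWitness (subst T (sym (allL-sound _ ls (∈-allV x))) tt)

isZero⇒¬isLinStr : ∀ m (h : BF m) α → isZero α ≡ true → isLinStr m h α ≡ false
isZero⇒¬isLinStr m h α z rewrite z = refl

half-≤ : ∀ {p q} → p ℕ.+ p ℕ.≤ q ℕ.+ q → p ℕ.≤ q
half-≤ {p} {q} le = NP.*-cancelˡ-≤ 2 (subst₂ ℕ._≤_ (double p) (double q) le)
  where
  double : ∀ n → n ℕ.+ n ≡ 2 ℕ.* n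
  double n = cong (n ℕ.+_) (sym (NP.+-identityʳ n))

rescale : ∀ j L D K .{{_ : ℕ.NonZero K}} →
  2 ^ suc (suc j) ℕ.* ((1 ℕ.+ L) ℕ.* K) ℕ.≤ ((D ℕ.+ D) ℕ.* (D ℕ.+ D)) ℕ.* K → 2 ^ j ℕ.* (1 ℕ.+ L) ℕ.≤ D ℕ.* D
rescale j L D K le = NP.*-cancelˡ-≤ 4 (subst₂ ℕ._≤_ (quadruple (2 ^ j) L) (square-double D)
  (NP.*-cancelʳ-≤ _ _ K (subst (ℕ._≤ ((D ℕ.+ D) ℕ.* (D ℕ.+ D)) ℕ.* K) (sym (NP.*-assoc (2 ^ suc (suc j)) (1 ℕ.+ L) K)) le)))
  where
  quadruple : ∀ x L → (2 ℕ.* (2 ℕ.* x)) ℕ.* (1 ℕ.+ L) ≡ 4 ℕ.* (x ℕ.* (1 ℕ.+ L))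
  quadruple = ℕ-Solver.solve-∀
  square-double : ∀ D → (D ℕ.+ D) ℕ.* (D ℕ.+ D) ≡ 4 ℕ.* (D ℕ.* D)
  square-double = ℕ-Solver.solve-∀

-- The function (h | l ⊕ g) when l is a translate of h

module Fcor {j : ℕ} (h l : BF (suc j)) (b : Bool) (a : V (suc j)) (l≡h∘⊕a : ∀ y → l y ≡ h (y ⊕ a)) where

  private
    m = suc j
    f = fcor m h l b

  second-half : ∀ y → l y xor gsum b y ≡ h (y ⊕ a) xor aff ones b y
  second-half y = cong₂ _xor_ (l≡h∘⊕a y) (gsum≡aff-ones b y)

  walsh-fcor : ∀ α t → walsh f (α ∷ʳ t) ≡ walsh h α + sgn (t xor (b xor dot (α ⊕ ones) a)) * walsh h (α ⊕ ones)
  walsh-fcor α t = begin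
    walsh f (α ∷ʳ t)
      ≡⟨ walsh-conc h (λ y → l y xor gsum b y) α t ⟩
    walsh h α + sgn t * walsh (λ y → l y xor gsum b y) α
      ≡⟨ cong (λ w → walsh h α + sgn t * w) (walsh-cong second-half α) ⟩
    walsh h α + sgn t * walsh (λ y → h (y ⊕ a) xor aff ones b y) α
      ≡⟨ cong (λ w → walsh h α + sgn t * w) (walsh-xor-aff (λ y → h (y ⊕ a)) ones b α) ⟩
    walsh h α + sgn t * (sgn b * walsh (λ y → h (y ⊕ a)) (α ⊕ ones))
      ≡⟨ cong (λ w → walsh h α + sgn t * (sgn b * w)) (walsh-translate h a (α ⊕ ones)) ⟩
    walsh h α + sgn t * (sgn b * (χ (α ⊕ ones) a * walsh h (α ⊕ ones)))
      ≡⟨ cong (_+_ (walsh h α)) (regroup (sgn t) (sgn b) (χ (α ⊕ ones) a) (walsh h (α ⊕ ones))) ⟩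
    walsh h α + (sgn t * (sgn b * χ (α ⊕ ones) a)) * walsh h (α ⊕ ones)
      ≡⟨ cong (λ s → walsh h α + s * walsh h (α ⊕ ones)) (trans (sgn-xor t (b xor dot (α ⊕ ones) a)) (cong (sgn t *_) (sgn-xor b (dot (α ⊕ ones) a)))) ⟨
    walsh h α + sgn (t xor (b xor dot (α ⊕ ones) a)) * walsh h (α ⊕ ones)
      ∎
    where
    open ≡-Reasoning
    regroup : ∀ T B C W → T * (B * (C * W)) ≡ (T * (B * C)) * W
    regroup = solve-∀

  sgn*walsh-fcor≤ : ∀ α t c → sgn c * walsh f (α ∷ʳ t) ≤ + (2 ^ m)
  sgn*walsh-fcor≤ α t c = begin
    sgn c * walsh f (α ∷ʳ t)
      ≡⟨ cong (sgn c *_) (walsh-fcor α t) ⟩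
    sgn c * (walsh h α + sgn e * walsh h (α ⊕ ones))
      ≡⟨ distribute (sgn c) (walsh h α) (sgn e) (walsh h (α ⊕ ones)) ⟩
    sgn c * walsh h α + (sgn c * sgn e) * walsh h (α ⊕ ones)
      ≡⟨ cong (λ s → sgn c * walsh h α + s * walsh h (α ⊕ ones)) (sgn-xor c e) ⟨
    sgn c * walsh h α + sgn (c xor e) * walsh h (α ⊕ ones)
      ≤⟨ walsh-two-point-bound h (λ eq → ones≢zeros (trans (sym (⊕-cancelˡ α ones)) eq)) c (c xor e) ⟩
    + (2 ^ m)
      ∎
    where
    open ZP.≤-Reasoning
    e = t xor (b xor dot (α ⊕ ones) a)
    distribute : ∀ C W E W' → C * (W + E * W') ≡ C * W + (C * E) * W'
    distribute = solve-∀

  dist-fcor≥ : ∀ u c → 2 ^ j ℕ.≤ dist (suc m) f (aff u c)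
  dist-fcor≥ u c with initLast u
  ... | α , t , refl = half-≤ (ZP.drop‿+≤+ (begin
    + (2 ^ j) + + (2 ^ j)                              ≡⟨ 2^-suc j ⟨
    + (2 ^ m)                                          ≡⟨ shuffle (+ (2 ^ m)) ⟩
    (+ (2 ^ m) + + (2 ^ m)) - + (2 ^ m)                ≤⟨ ZP.+-monoʳ-≤ (+ (2 ^ m) + + (2 ^ m)) (ZP.neg-mono-≤ (sgn*walsh-fcor≤ α t c)) ⟩
    (+ (2 ^ m) + + (2 ^ m)) - sgn c * walsh f (α ∷ʳ t) ≡⟨ cong (λ z → z - sgn c * walsh f (α ∷ʳ t)) (2^-suc m) ⟨
    + (2 ^ suc m) - sgn c * walsh f (α ∷ʳ t)           ≡⟨ dist-walsh (suc m) f (α ∷ʳ t) c ⟨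
    + d + + d                                          ∎))
    where
    open ZP.≤-Reasoning
    d = dist (suc m) f (aff (α ∷ʳ t) c)
    shuffle : ∀ P → P ≡ (P + P) - P
    shuffle = solve-∀

  NL-fcor≥ : 2 ^ j ℕ.≤ NL (suc m) f
  NL-fcor≥ = ≤NL (suc m) f (NP.^-monoʳ-≤ 2 (NP.m≤n+m j 2)) dist-fcor≥

  NL-fcor≤ : Balanced m f → NL (suc m) f ℕ.≤ 2 ^ m
  NL-fcor≤ balanced = subst (NL (suc m) f ℕ.≤_) balanced (NL≤wtF (suc m) f)

  Δ-fcor : ∀ α → isEven (hw α) ≡ true → Δ f (α ∷ʳ false) ≡ Δ h α + Δ h α
  Δ-fcor α even = begin
    Δ f (α ∷ʳ false)                                              ≡⟨ Δ-conc h (λ y → l y xor gsum b y) α ⟩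
    Δ h α + Δ (λ y → l y xor gsum b y) α                          ≡⟨ cong (_+_ (Δ h α)) (Δ-cong second-half α) ⟩
    Δ h α + Δ (λ y → h (y ⊕ a) xor aff ones b y) α                ≡⟨ cong (_+_ (Δ h α)) (Δ-xor-aff (λ y → h (y ⊕ a)) ones b α) ⟩
    Δ h α + χ ones α * Δ (λ y → h (y ⊕ a)) α                      ≡⟨ cong (λ z → Δ h α + z * Δ (λ y → h (y ⊕ a)) α) χ-ones-even ⟩
    Δ h α + + 1 * Δ (λ y → h (y ⊕ a)) α                           ≡⟨ cong (_+_ (Δ h α)) (trans (ZP.*-identityˡ _) (Δ-translate h a α)) ⟩
    Δ h α + Δ h α                                                 ∎
    where
    open ≡-Reasoning
    χ-ones-even : χ ones α ≡ + 1
    χ-ones-even rewrite dot-ones α | even = refl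

  private
    K : ℤ
    K = + (2 ^ suc m) * + (2 ^ suc m)

  Δ²-fcor-structure : ∀ α c → (∀ x → h x xor h (x ⊕ α) ≡ c) → isEven (hw α) ≡ true →
    Δ f (α ∷ʳ false) * Δ f (α ∷ʳ false) ≡ K
  Δ²-fcor-structure α c structure even = begin
    Δ f (α ∷ʳ false) * Δ f (α ∷ʳ false)                 ≡⟨ cong (λ z → z * z) (trans (Δ-fcor α even) (cong₂ _+_ Δh Δh)) ⟩
    (P * s + P * s) * (P * s + P * s)                   ≡⟨ square (P) s ⟩
    ((P + P) * (P + P)) * (s * s)                       ≡⟨ cong (((P + P) * (P + P)) *_) (sgn*sgn c) ⟩
    ((P + P) * (P + P)) * + 1                           ≡⟨ ZP.*-identityʳ _ ⟩
    (P + P) * (P + P)                                   ≡⟨ cong (λ z → z * z) (2^-suc m) ⟨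
    K                                                   ∎
    where
    open ≡-Reasoning
    P = + (2 ^ m)
    s = sgn c
    Δh : Δ h α ≡ P * s
    Δh = Δ-linear-structure h α c structure
    square : ∀ P s → (P * s + P * s) * (P * s + P * s) ≡ ((P + P) * (P + P)) * (s * s)
    square = solve-∀

  isEvenLinStr : V m → Bool
  isEvenLinStr α = isLinStr m h α ∧ isEven (hw α)

  Δ²-fcor≥ : ∀ α → (+ b2n (isZero α) + + b2n (isEvenLinStr α)) * K ≤ Δ f (α ∷ʳ false) * Δ f (α ∷ʳ false)
  Δ²-fcor≥ α = bound (isZero α) (isEvenLinStr α) refl refl
    where
    equality : ∀ {c} → (∀ x → h x xor h (x ⊕ α) ≡ c) → isEven (hw α) ≡ true →
      + 1 * K ≤ Δ f (α ∷ʳ false) * Δ f (α ∷ʳ false)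
    equality structure even = ZP.≤-reflexive (trans (ZP.*-identityˡ K) (sym (Δ²-fcor-structure α _ structure even)))
    bound : ∀ z e → isZero α ≡ z → isEvenLinStr α ≡ e → (+ b2n z + + b2n e) * K ≤ Δ f (α ∷ʳ false) * Δ f (α ∷ʳ false)
    bound true true z ls with () ← trans (sym ls) (cong (_∧ isEven (hw α)) (isZero⇒¬isLinStr m h α z))
    bound true false z _ = equality
      (λ x → trans (cong (λ y → h x xor h (x ⊕ y)) α≡0) (trans (cong (λ y → h x xor h y) (⊕-identityʳ x)) (BP.xor-same (h x))))
      (trans (cong (λ y → isEven (hw y)) α≡0) (cong isEven (hw-zeros {m})))
      where α≡0 = isZero⇒≡zeros α z
    bound false true _ ls = equality (isLinStr⇒linear-structure m h α (proj₁ (∧-true ls))) (proj₂ (∧-true ls))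
    bound false false _ _ = square-nonneg (Δ f (α ∷ʳ false))

  ∑Δ²-fcor≥ : (+ 1 + + Leven m h) * K ≤ ∑ (suc m) (λ β → Δ f β * Δ f β)
  ∑Δ²-fcor≥ = begin
    (+ 1 + + Leven m h) * K
      ≡⟨ cong (_* K) (cong₂ _+_ (∑-isZero m) (sym Leven≡∑)) ⟨
    (∑ m (λ α → + b2n (isZero α)) + ∑ m (λ α → + b2n (isEvenLinStr α))) * K
      ≡⟨ cong (_* K) (∑-+ m (λ α → + b2n (isZero α)) (λ α → + b2n (isEvenLinStr α))) ⟨
    ∑ m (λ α → + b2n (isZero α) + + b2n (isEvenLinStr α)) * K
      ≡⟨ ∑-*ʳ m K (λ α → + b2n (isZero α) + + b2n (isEvenLinStr α)) ⟨
    ∑ m (λ α → (+ b2n (isZero α) + + b2n (isEvenLinStr α)) * K)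
      ≤⟨ ∑-mono m Δ²-fcor≥ ⟩
    ∑ m (λ α → Δ² (α ∷ʳ false))
      ≤⟨ ZP.i≤i+j _ (∑ m (λ α → Δ² (α ∷ʳ true))) {{nonNegative (∑-nonneg m (λ α → square-nonneg (Δ f (α ∷ʳ true))))}} ⟩
    ∑ m (λ α → Δ² (α ∷ʳ false)) + ∑ m (λ α → Δ² (α ∷ʳ true))
      ≡⟨ ∑-∷ʳ m Δ² ⟨
    ∑ (suc m) Δ²
      ∎
    where
    open ZP.≤-Reasoning
    Δ² : V (suc m) → ℤ
    Δ² β = Δ f β * Δ f β
    Leven≡∑ : + Leven m h ≡ ∑ m (λ α → + b2n (isEvenLinStr α))
    Leven≡∑ = trans (cong +_ (length-filter≡count isEvenLinStr (allV m))) (+wtF≡∑ m isEvenLinStr)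

  NL-fcor-spectral : Balanced m f →
    2 ^ j ℕ.* (1 ℕ.+ Leven m h) ℕ.≤ (2 ^ m ℕ.∸ NL (suc m) f) ℕ.* (2 ^ m ℕ.∸ NL (suc m) f)
  NL-fcor-spectral balanced = rescale j (Leven m h) D K′ {{K′≢0}} (ZP.drop‿+≤+ (begin
    + (2 ^ suc m ℕ.* ((1 ℕ.+ Leven m h) ℕ.* K′))     ≡⟨ trans (ZP.pos-* (2 ^ suc m) _) (cong (+ (2 ^ suc m) *_)
                                                         (trans (ZP.pos-* (1 ℕ.+ Leven m h) K′) (cong₂ _*_ (ZP.pos-+ 1 (Leven m h)) (ZP.pos-* (2 ^ suc m) (2 ^ suc m))))) ⟩
    + (2 ^ suc m) * ((+ 1 + + Leven m h) * K)         ≤⟨ ZP.*-monoˡ-≤-nonNeg (+ (2 ^ suc m)) ∑Δ²-fcor≥ ⟩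
    + (2 ^ suc m) * ∑ (suc m) (λ β → Δ f β * Δ f β)   ≤⟨ fourth-moment-bound (suc m) f ⟩
    (A * A) * K                                       ≡⟨ cong (λ z → (z * z) * K) A≡D+D ⟩
    (+ (D ℕ.+ D) * + (D ℕ.+ D)) * K                   ≡⟨ trans (ZP.pos-* ((D ℕ.+ D) ℕ.* (D ℕ.+ D)) K′) (cong₂ _*_ (ZP.pos-* (D ℕ.+ D) (D ℕ.+ D)) (ZP.pos-* (2 ^ suc m) (2 ^ suc m))) ⟨
    + (((D ℕ.+ D) ℕ.* (D ℕ.+ D)) ℕ.* K′)              ∎))
    where
    open ZP.≤-Reasoning
    N = NL (suc m) f
    D = 2 ^ m ℕ.∸ N
    A = + (2 ^ suc m) - (+ N + + N)
    K′ = 2 ^ suc m ℕ.* 2 ^ suc m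
    K′≢0 : ℕ.NonZero K′
    K′≢0 = NP.m*n≢0 (2 ^ suc m) (2 ^ suc m) {{NP.m^n≢0 2 (suc m)}} {{NP.m^n≢0 2 (suc m)}}
    2^m≡N+D : + (2 ^ m) ≡ + N + + D
    2^m≡N+D = trans (cong +_ (sym (NP.m+[n∸m]≡n (NL-fcor≤ balanced)))) (ZP.pos-+ N D)
    cancel : ∀ N D → ((N + D) + (N + D)) - (N + N) ≡ D + D
    cancel = solve-∀
    A≡D+D : A ≡ + (D ℕ.+ D)
    A≡D+D = begin-equality
      + (2 ^ suc m) - (+ N + + N)                 ≡⟨ cong (λ z → z - (+ N + + N)) (trans (2^-suc m) (cong₂ _+_ 2^m≡N+D 2^m≡N+D)) ⟩
      ((+ N + + D) + (+ N + + D)) - (+ N + + N)   ≡⟨ cancel (+ N) (+ D) ⟩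
      + D + + D                                   ≡⟨ ZP.pos-+ D D ⟨
      + (D ℕ.+ D)                                 ∎

  walsh-fcor-affine : ∀ a₀ c₀ → (∀ x → h x ≡ aff a₀ c₀ x) → sgn c₀ * walsh f (a₀ ∷ʳ false) ≡ + (2 ^ m)
  walsh-fcor-affine a₀ c₀ h≡aff = begin
    sgn c₀ * walsh f (a₀ ∷ʳ false)
      ≡⟨ cong (sgn c₀ *_) (walsh-fcor a₀ false) ⟩
    sgn c₀ * (walsh h a₀ + sgn e * walsh h (a₀ ⊕ ones))
      ≡⟨ cong₂ (λ p q → sgn c₀ * (p + sgn e * q)) (walsh-h a₀) (walsh-h (a₀ ⊕ ones)) ⟩
    sgn c₀ * (sgn c₀ * ∑ m (χ (a₀ ⊕ a₀)) + sgn e * (sgn c₀ * ∑ m (χ ((a₀ ⊕ ones) ⊕ a₀))))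
      ≡⟨ cong₂ (λ p q → sgn c₀ * (sgn c₀ * p + sgn e * (sgn c₀ * q)))
               (trans (cong (λ v → ∑ m (χ v)) (⊕-self a₀)) (∑-χ-zeros m))
               (trans (cong (λ v → ∑ m (χ v)) (trans (⊕-comm (a₀ ⊕ ones) a₀) (⊕-cancelˡ a₀ ones))) (∑-χ-nonzero ones (ones≢zeros {j}))) ⟩
    sgn c₀ * (sgn c₀ * + (2 ^ m) + sgn e * (sgn c₀ * + 0))
      ≡⟨ collapse (sgn c₀) (sgn e) (+ (2 ^ m)) ⟩
    (sgn c₀ * sgn c₀) * + (2 ^ m)
      ≡⟨ cong (_* + (2 ^ m)) (sgn*sgn c₀) ⟩
    + 1 * + (2 ^ m)
      ≡⟨ ZP.*-identityˡ (+ (2 ^ m)) ⟩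
    + (2 ^ m)
      ∎
    where
    open ≡-Reasoning
    e = false xor (b xor dot (a₀ ⊕ ones) a)
    walsh-h : ∀ u → walsh h u ≡ sgn c₀ * ∑ m (χ (u ⊕ a₀))
    walsh-h u = trans (walsh-cong h≡aff u) (walsh-aff a₀ c₀ u)
    collapse : ∀ C E P → C * (C * P + E * (C * + 0)) ≡ (C * C) * P
    collapse = solve-∀

  NL-fcor-affine : IsAffine m h → NL (suc m) f ℕ.≤ 2 ^ j
  NL-fcor-affine (a₀ , c₀ , h≡aff) = NP.≤-trans (NL≤dist (suc m) f (a₀ ∷ʳ false) c₀) (half-≤ (NP.≤-reflexive d+d≡2^m))
    where
    d = dist (suc m) f (aff (a₀ ∷ʳ false) c₀)
    shuffle : ∀ P → (P + P) - P ≡ P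
    shuffle = solve-∀
    d+d≡2^m : d ℕ.+ d ≡ 2 ^ j ℕ.+ 2 ^ j
    d+d≡2^m = ZP.+-injective (begin
      + (d ℕ.+ d)                                      ≡⟨ ZP.pos-+ d d ⟩
      + d + + d                                        ≡⟨ dist-walsh (suc m) f (a₀ ∷ʳ false) c₀ ⟩
      + (2 ^ suc m) - sgn c₀ * walsh f (a₀ ∷ʳ false)   ≡⟨ cong₂ _-_ (2^-suc m) (walsh-fcor-affine a₀ c₀ h≡aff) ⟩
      (+ (2 ^ m) + + (2 ^ m)) - + (2 ^ m)              ≡⟨ shuffle (+ (2 ^ m)) ⟩
      + (2 ^ m)                                        ≡⟨ 2^-suc j ⟩
      + (2 ^ j) + + (2 ^ j)                            ≡⟨ ZP.pos-+ (2 ^ j) (2 ^ j) ⟨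
      + (2 ^ j ℕ.+ 2 ^ j)                              ∎)
      where open ≡-Reasoning

translation-vector : ∀ {n} {h l : BF n} → ((∀ x → l x ≡ h x) ⊎ Σ (V n) (λ a → OddWt a × (∀ x → l x ≡ h (x ⊕ a)))) →
  Σ (V n) (λ a → ∀ x → l x ≡ h (x ⊕ a))
translation-vector {h = h} (inj₁ l≡h) = zeros , λ x → trans (l≡h x) (cong h (sym (⊕-identityʳ x)))
translation-vector (inj₂ (a , _ , l≡h∘⊕a)) = a , l≡h∘⊕a

corollary3 : (m : ℕ) → 2 ℕ.≤ m → (h : BF m) → 1 ℕ.≤ Leven m h → (b : Bool) → (l : BF m) →
    ((∀ x → l x ≡ h x) ⊎ Σ (V m) (λ a → OddWt a × (∀ x → l x ≡ h (x ⊕ a)))) →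
    Balanced m (fcor m h l b) →
    (2 ^ (m ℕ.∸ 1) ℕ.≤ NL (suc m) (fcor m h l b)
      × NL (suc m) (fcor m h l b) ℕ.≤ 2 ^ m
      × 2 ^ (m ℕ.∸ 1) ℕ.* (1 ℕ.+ Leven m h)
          ℕ.≤ (2 ^ m ℕ.∸ NL (suc m) (fcor m h l b)) ℕ.* (2 ^ m ℕ.∸ NL (suc m) (fcor m h l b))
      × (IsAffine m h → SAC (suc m) (fcor m h l b) → NL (suc m) (fcor m h l b) ≡ 2 ^ (m ℕ.∸ 1)))
corollary3 (suc j) _ h _ b l l-shape balanced =
    NL-fcor≥
  , NL-fcor≤ balanced
  , NL-fcor-spectral balanced
  , λ affine _ → NP.≤-antisym (NL-fcor-affine affine) NL-fcor≥
  where
  a = proj₁ (translation-vector l-shape)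
  open Fcor h l b a (proj₂ (translation-vector l-shape))
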